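{- Let $(\mathsf D,\Upsilon)\in\mathrm{SSPF}_{\mathbf w}(m,n)$ and $(\mathsf D',\varphi)=\mathrm{std}(\mathsf D,\Upsilon)$. Then $\mathsf D'=\mathsf D$.
   Context: Fix coprime positive integers $m,n$, a positive integer $r$, and $\mathbf w=(w_1,\dots,w_r)\in\mathbb Z^r_{\ge0}$ with $\sum w_i=m$. An $(m,n)$-Dyck path $\mathsf D$ is a lattice path from $(0,m)$ to $(n,0)$ of unit south and east steps staying weakly below $mx+ny=mn$; its vertical steps $v_0,\dots,v_{m-1}$ (top to bottom) have top endpoints $(a_j,m-j)$, identified with $v_j$; $v_j,v_{j+1}$ are consecutive if $a_j=a_{j+1}$. $\gamma(x,y)=mn-mx-ny$. A rank $r$ semistandard $(m,n)$-parking function is $(\mathsf D,\Upsilon)$ with $\Upsilon:\{v_j\}\to\{1,\dots,r\}$, $\Upsilon(v_j)\le\Upsilon(v_{j+1})$ for consecutive steps; weight $(|\Upsilon^{ -1}(i)|)_i$; $\mathrm{SSPF}_{\mathbf w}(m,n)$ those of weight $\mathbf w$. An $(m,n)$-parking function is $(\mathsf D,\varphi)$ with $\varphi:\{v_j\}\to\{1,\dots,m\}$ bijective, strictly increasing on consecutive steps; set $\mathrm{PF}_{m,n}$. $(m,r)$-affine composition: $f:\mathbb Z\to\mathbb Z$, $f(x+m)=f(x)+r$, $f^{ -1}([1,r])$ of size $m$, distinct mod $m$, sum $m(m+1)/2$; weight $(|f^{ -1}(i)|)_{i=1}^r$; $n$-stable if $f(x+n)\ge f(x)$. $\widetilde S_m$: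 bijections with $\sigma(x+m)=\sigma(x)+m$, $\sum_{i=1}^m\sigma(i)=m(m+1)/2$. $\mathcal A_{\mathbf w}(\mathsf D,\Upsilon)(x)=\tilde f(x+k)$, where $\tilde f(\gamma(v_j)+pm)=\Upsilon(v_j)+pr$ ($p\in\mathbb Z$) and $\sum_{j}(\gamma(v_j)-(j+1))=km$; it is a bijection from $\mathrm{SSPF}_{\mathbf w}(m,n)$ onto $n$-stable affine compositions of weight $\mathbf w$, and $\mathcal A=\mathcal A_{(1^m)}$ is a bijection from $\mathrm{PF}_{m,n}$ onto $n$-stable elements of $\widetilde S_m$. $f_{\mathbf w}(x)=i$ for $w_1+\dots+w_{i-1}<x\le w_1+\dots+w_i$, $f_{\mathbf w}(x+m)=f_{\mathbf w}(x)+r$. For $f$ of weight $\mathbf w$ there is a unique $\sigma\in\widetilde S_m$ with $f=f_{\mathbf w}\circ\sigma$ and $\sigma^{ -1}(a)<\sigma^{ -1}(b)$ whenever $a<b$, $f_{\mathbf w}(a)=f_{\mathbf w}(b)$ (it is $n$-stable if $f$ is), and $\mathrm{std}(\mathsf D,\Upsilon)=\mathcal A^{ -1}(\sigma)$ for $f=\mathcal A_{\mathbf w}(\mathsf D,\Upsilon)$. -}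

module Defs where

open import Data.Nat as ℕ using (ℕ; zero; suc; _≤_; _<_; _∸_)
open import Data.Integer as ℤ using (ℤ; +_)
open import Data.Fin using (Fin; toℕ)
open import Data.Fin.Properties using (_≟_)
open import Data.List using (List; map; foldr; filter; length; allFin)
open import Data.Nat.ListAction using (sum)
open import Data.Product using (Σ; _×_)
open import Relation.Binary.PropositionalEquality using (_≡_)
open import Function.Definitions using (Injective; Surjective; Bijective)

sumℤ : List ℤ → ℤ
sumℤ = foldr ℤ._+_ (+ 0)

γ : ℕ → ℕ → ℤ → ℤ → ℤ
γ m n x y = + (m ℕ.* n) ℤ.- (+ m ℤ.* x) ℤ.- (+ n ℤ.* y)

-- An (m,n)-Dyck path is encoded by a : Fin m → ℕ, where a j is the
-- x-coordinate of the vertical step v_j (top endpoint (a j , m - j)).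
-- γ of the top endpoint of v_j:
γv : (m n : ℕ) → (Fin m → ℕ) → Fin m → ℤ
γv m n a j = γ m n (+ a j) (+ m ℤ.- + toℕ j)

-- the sequence a describes a lattice path of south/east steps from (0,m)
-- to (n,0) weakly below mx + ny = mn (the rightmost lattice point of each
-- row y = m - j is the top endpoint of v_j, so the condition is γ ≥ 0 there)
IsDyck : (m n : ℕ) → (Fin m → ℕ) → Set
IsDyck m n a =
  (∀ (i j : Fin m) → toℕ j ≡ suc (toℕ i) → a i ≤ a j)
  × (∀ (j : Fin m) → + 0 ℤ.≤ γv m n a j)

Consecutive : {m : ℕ} → (Fin m → ℕ) → Fin m → Fin m → Set
Consecutive a i j = (toℕ j ≡ suc (toℕ i)) × (a i ≡ a j)

count : {m r : ℕ} → (Fin m → Fin r) → Fin r → ℕ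
count {m} Υ i = length (filter (λ j → Υ j ≟ i) (allFin m))

-- (a , Υ) ∈ SSPF_w(m,n); labels Fin r ≅ {1,…,r} via suc ∘ toℕ
IsSSPF : (m n r : ℕ) → (Fin r → ℕ) → (Fin m → ℕ) → (Fin m → Fin r) → Set
IsSSPF m n r w a Υ =
  IsDyck m n a
  × (∀ i j → Consecutive a i j → toℕ (Υ i) ≤ toℕ (Υ j))
  × (∀ (i : Fin r) → count Υ i ≡ w i)

-- (a , φ) ∈ PF_{m,n}; labels Fin m ≅ {1,…,m}
IsPF : (m n : ℕ) → (Fin m → ℕ) → (Fin m → Fin m) → Set
IsPF m n a φ =
  IsDyck m n a
  × Bijective _≡_ _≡_ φ
  × (∀ i j → Consecutive a i j → toℕ (φ i) ℕ.< toℕ (φ j))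

lab : {m r : ℕ} → (Fin m → Fin r) → Fin m → ℤ
lab Υ j = + suc (toℕ (Υ j))

-- f = A_w(a, Υ) (with labels L):  there is k with
-- Σ_j (γ(v_j) - (j+1)) = k m, and f(x) = f̃(x + k) where
-- f̃(γ(v_j) + p m) = L(v_j) + p r, i.e. f(γ(v_j) + p m - k) = L(v_j) + p r.
IsAImage : (m n r : ℕ) → (a : Fin m → ℕ) → (L : Fin m → ℤ) → (ℤ → ℤ) → Set
IsAImage m n r a L f =
  Σ ℤ λ k →
    (k ℤ.* + m ≡ sumℤ (map (λ j → γv m n a j ℤ.- + suc (toℕ j)) (allFin m)))
    × (∀ (j : Fin m) (p : ℤ) →
         f (γv m n a j ℤ.+ p ℤ.* + m ℤ.- k) ≡ L j ℤ.+ p ℤ.* + r)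

pref : {r : ℕ} → (Fin r → ℕ) → Fin r → ℕ
pref {r} w i = sum (map w (filter (λ i' → toℕ i' ℕ.<? toℕ i) (allFin r)))

-- graph of f_w :  f_w(x) = y,  where x = q m + s with 1 ≤ s ≤ m and
-- f_w(s) = i (as value suc (toℕ i)) iff pref i < s ≤ pref i + w i,
-- f_w(x) = f_w(s) + q r
FwRel : (m r : ℕ) → (Fin r → ℕ) → ℤ → ℤ → Set
FwRel m r w x y =
  Σ ℤ λ q → Σ (Fin r) λ i → Σ ℕ λ s →
    (x ≡ q ℤ.* + m ℤ.+ + s)
    × (pref w i ℕ.< s) × (s ℕ.≤ pref w i ℕ.+ w i)
    × (y ≡ + suc (toℕ i) ℤ.+ q ℤ.* + r)

IsAffinePerm : ℕ → (ℤ → ℤ) → Set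
IsAffinePerm m σ =
  Bijective _≡_ _≡_ σ
  × (∀ x → σ (x ℤ.+ + m) ≡ σ x ℤ.+ + m)
  × (sumℤ (map (λ i → σ (+ suc (toℕ i))) (allFin m)) ≡ + ((m ℕ.* suc m) ℕ./ 2))

-- σ⁻¹(a) < σ⁻¹(b) whenever a < b and f_w(a) = f_w(b)
-- (stated with a = σ x, b = σ y, σ being a bijection)
StdOrder : (m r : ℕ) → (Fin r → ℕ) → (ℤ → ℤ) → Set
StdOrder m r w σ =
  ∀ (x y : ℤ) → σ x ℤ.< σ y →
    (Σ ℤ λ c → FwRel m r w (σ x) c × FwRel m r w (σ y) c) → x ℤ.< y

{-# OPTIONS --safe #-}
-- For each vertical step v_j of D, f(γ(v_j) − k) = Υ(v_j) lies in [1, r]; since f = f_w ∘ σ,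
-- σ(γ(v_j) − k) lies in [1, m], so it is a label φ(v'_j') = σ(γ(v'_j') − k') of the
-- standardisation, and injectivity of σ gives γ(v_j) − k = γ(v'_j') − k'.  As γ(v_j) ≡ n j
-- (mod m) and gcd(m, n) = 1, γ is injective on the vertical steps of a path, so j ↦ j' is a
-- permutation.  Comparing γ(v_0) ≤ 0 with γ ≥ 0 on both paths gives k = k'; then
-- γ(v_j) = γ(v'_j') forces j' = j and a'_j = a_j.
module Submission where

open import Defs
open import Data.Nat using (ℕ; _<_)
open import Data.Nat.Coprimality using (Coprime)
open import Data.Integer using (ℤ)
open import Data.Fin using (Fin)
open import Data.List using (map; allFin)
open import Data.Nat.ListAction using (sum)
open import Relation.Binary.PropositionalEquality using (_≡_)

open import Data.Nat as ℕ using (zero; suc; _≤_; s≤s; NonZero)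
import Data.Nat.Properties as ℕ
open import Data.Nat.Divisibility using (_∣_; m∣m*n; ∣m+n∣m⇒∣n; >⇒∤)
open import Data.Nat.Coprimality using (coprime-divisor)
import Data.Nat.Tactic.RingSolver as ℕ-Ring
open import Data.Integer as ℤ using (+_; +[1+_]; -[1+_]; 0ℤ; -_)
import Data.Integer.Properties as ℤ
import Data.Integer.Tactic.RingSolver as ℤ-Ring
open import Algebra.Properties.AbelianGroup ℤ.+-0-abelianGroup using (∙-cancelʳ)
open import Data.Fin as Fin using (toℕ; fromℕ<; punchOut)
import Data.Fin.Properties as Fin
open import Data.List using ([]; _∷_; filter)
open import Data.List.Membership.Propositional using (_∈_)
open import Data.List.Membership.Propositional.Properties using (∈-filter⁺; ∈-allFin)
open import Data.List.Relation.Unary.Any using (here; there)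
open import Data.Product using (∃; ∃₂; _×_; _,_; proj₁; proj₂)
open import Data.Sum using (inj₁; inj₂)
open import Algebra.Properties.CommutativeSemigroup ℕ.+-commutativeSemigroup using (x∙yz≈y∙xz)
open import Function.Definitions using (Injective)
open import Relation.Binary.PropositionalEquality using (_≢_; refl; sym; trans; cong; subst; module ≡-Reasoning)
open import Relation.Nullary using (¬_; yes; no; contradiction)
open import Relation.Unary using (Pred; Decidable)
open import Relation.Unary.Properties using (∁?)

coprime-offset-unique≤ : ∀ {m n i j a b} → Coprime m n → j < m → i ≤ j →
  n ℕ.* i ℕ.+ m ℕ.* b ≡ n ℕ.* j ℕ.+ m ℕ.* a → i ≡ j
coprime-offset-unique≤ {m} {n} {i} {a = a} {b} cop j<m i≤j eq with ℕ.m≤n⇒∃[o]m+o≡n i≤j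
... | zero  , refl = sym (ℕ.+-identityʳ i)
... | suc d , refl = contradiction (coprime-divisor cop m∣n[1+d]) (>⇒∤ 1+d<m)
  where
  regroup : ∀ n i d m a → n ℕ.* (i ℕ.+ d) ℕ.+ m ℕ.* a ≡ n ℕ.* i ℕ.+ (m ℕ.* a ℕ.+ n ℕ.* d)
  regroup = ℕ-Ring.solve-∀
  mb≡ma+n[1+d] : m ℕ.* b ≡ m ℕ.* a ℕ.+ n ℕ.* suc d
  mb≡ma+n[1+d] = ℕ.+-cancelˡ-≡ (n ℕ.* i) _ _ (trans eq (regroup n i (suc d) m a))
  m∣n[1+d] : m ∣ n ℕ.* suc d
  m∣n[1+d] = ∣m+n∣m⇒∣n (subst (m ∣_) mb≡ma+n[1+d] (m∣m*n b)) (m∣m*n a)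
  1+d<m : suc d < m
  1+d<m = ℕ.≤-<-trans (ℕ.m≤n+m (suc d) i) j<m

coprime-offset-unique : ∀ {m n i j a b} → Coprime m n → i < m → j < m →
  n ℕ.* i ℕ.+ m ℕ.* b ≡ n ℕ.* j ℕ.+ m ℕ.* a → i ≡ j
coprime-offset-unique {i = i} {j} cop i<m j<m eq with ℕ.≤-total i j
... | inj₁ i≤j = coprime-offset-unique≤ cop j<m i≤j eq
... | inj₂ j≤i = sym (coprime-offset-unique≤ cop i<m j≤i (sym eq))

i-j≡k-l⇒i+l≡k+j : ∀ i j k l → i ℤ.- j ≡ k ℤ.- l → i ℤ.+ l ≡ k ℤ.+ j
i-j≡k-l⇒i+l≡k+j i j k l eq = begin
  i ℤ.+ l                     ≡⟨ regroup i j l ⟩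
  (i ℤ.- j) ℤ.+ (j ℤ.+ l)     ≡⟨ cong (ℤ._+ (j ℤ.+ l)) eq ⟩
  (k ℤ.- l) ℤ.+ (j ℤ.+ l)     ≡⟨ regroup′ k l j ⟩
  k ℤ.+ j                     ∎
  where
  open ≡-Reasoning
  regroup : ∀ i j l → i ℤ.+ l ≡ (i ℤ.- j) ℤ.+ (j ℤ.+ l)
  regroup = ℤ-Ring.solve-∀
  regroup′ : ∀ k l j → (k ℤ.- l) ℤ.+ (j ℤ.+ l) ≡ k ℤ.+ j
  regroup′ = ℤ-Ring.solve-∀

i-k≡j-l⇒i≤j⇒k≤l : ∀ {i j k l : ℤ} → i ℤ.- k ≡ j ℤ.- l → i ℤ.≤ j → k ℤ.≤ l
i-k≡j-l⇒i≤j⇒k≤l {i} {j} {k} {l} eq i≤j = begin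
  k                   ≡⟨ undo i k ⟩
  i ℤ.- (i ℤ.- k)     ≤⟨ ℤ.+-monoˡ-≤ (- (i ℤ.- k)) i≤j ⟩
  j ℤ.- (i ℤ.- k)     ≡⟨ cong (λ x → j ℤ.- x) eq ⟩
  j ℤ.- (j ℤ.- l)     ≡⟨ undo j l ⟨
  l                   ∎
  where
  open ℤ.≤-Reasoning
  undo : ∀ i k → k ≡ i ℤ.- (i ℤ.- k)
  undo = ℤ-Ring.solve-∀

γv-normal : ∀ m n (a : Fin m → ℕ) j → γv m n a j ≡ + (n ℕ.* toℕ j) ℤ.- + (m ℕ.* a j)
γv-normal m n a j
  rewrite ℤ.pos-* m n | ℤ.pos-* n (toℕ j) | ℤ.pos-* m (a j) = expand (+ m) (+ n) (+ toℕ j) (+ a j)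
  where
  expand : ∀ m n j x → m ℤ.* n ℤ.- m ℤ.* x ℤ.- n ℤ.* (m ℤ.- j) ≡ n ℤ.* j ℤ.- m ℤ.* x
  expand = ℤ-Ring.solve-∀

γv-zero≤0 : ∀ {m} n (a : Fin (suc m) → ℕ) → γv (suc m) n a Fin.zero ℤ.≤ 0ℤ
γv-zero≤0 {m} n a rewrite γv-normal (suc m) n a Fin.zero | ℕ.*-zeroʳ n
  | ℤ.+-identityˡ (- + (suc m ℕ.* a Fin.zero)) = ℤ.neg-≤-pos

γv-injective : ∀ {m n} .{{_ : NonZero m}} → Coprime m n → (a b : Fin m → ℕ) {i j : Fin m} →
  γv m n a i ≡ γv m n b j → i ≡ j × a i ≡ b j
γv-injective {m} {n} cop a b {i} {j} eq = Fin.toℕ-injective i≡j , ai≡bj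
  where
  in-ℕ : n ℕ.* toℕ i ℕ.+ m ℕ.* b j ≡ n ℕ.* toℕ j ℕ.+ m ℕ.* a i
  in-ℕ = ℤ.+-injective (i-j≡k-l⇒i+l≡k+j
    (+ (n ℕ.* toℕ i)) (+ (m ℕ.* a i)) (+ (n ℕ.* toℕ j)) (+ (m ℕ.* b j))
    (trans (sym (γv-normal m n a i)) (trans eq (γv-normal m n b j))))
  i≡j : toℕ i ≡ toℕ j
  i≡j = coprime-offset-unique cop (Fin.toℕ<n i) (Fin.toℕ<n j) in-ℕ
  ai≡bj : a i ≡ b j
  ai≡bj = sym (ℕ.*-cancelˡ-≡ (b j) (a i) m (ℕ.+-cancelˡ-≡ (n ℕ.* toℕ i) _ _
    (trans in-ℕ (cong (λ t → n ℕ.* t ℕ.+ m ℕ.* a i) (sym i≡j)))))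

module _ {A : Set} (w : A → ℕ) where

  sum-filter-split : ∀ {p} {P : Pred A p} (P? : Decidable P) xs →
    sum (map w (filter P? xs)) ℕ.+ sum (map w (filter (∁? P?) xs)) ≡ sum (map w xs)
  sum-filter-split P? [] = refl
  sum-filter-split P? (x ∷ xs) with P? x
  ... | yes _ = trans (ℕ.+-assoc (w x) _ _) (cong (w x ℕ.+_) (sum-filter-split P? xs))
  ... | no _  = trans (x∙yz≈y∙xz (sum (map w (filter P? xs))) (w x) _)
                      (cong (w x ℕ.+_) (sum-filter-split P? xs))

  ∈⇒≤sum : ∀ {x xs} → x ∈ xs → w x ≤ sum (map w xs)
  ∈⇒≤sum {xs = y ∷ _} (here refl) = ℕ.m≤m+n (w y) _
  ∈⇒≤sum {xs = y ∷ _} (there x∈) = ℕ.≤-trans (∈⇒≤sum x∈) (ℕ.m≤n+m _ (w y))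

pref+w≤sum : ∀ {r} (w : Fin r → ℕ) (i : Fin r) → pref w i ℕ.+ w i ≤ sum (map w (allFin r))
pref+w≤sum {r} w i = begin
  pref w i ℕ.+ w i                                      ≤⟨ ℕ.+-monoʳ-≤ (pref w i) i-not-below ⟩
  pref w i ℕ.+ sum (map w (filter (∁? below?) (allFin r))) ≡⟨ sum-filter-split w below? (allFin r) ⟩
  sum (map w (allFin r))                                ∎
  where
  open ℕ.≤-Reasoning
  below? : Decidable (λ i′ → toℕ i′ < toℕ i)
  below? i′ = toℕ i′ ℕ.<? toℕ i
  i-not-below : w i ≤ sum (map w (filter (∁? below?) (allFin r)))
  i-not-below = ∈⇒≤sum w (∈-filter⁺ (∁? below?) (∈-allFin i) (ℕ.<-irrefl refl))

label : {k : ℕ} → Fin k → ℤ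
label t = + suc (toℕ t)

exceeds-period : ∀ {r x y} q → + x ≡ + suc y ℤ.+ +[1+ q ] ℤ.* + r → r < x
exceeds-period {r} {x} {y} q eq =
  subst (r <_) (sym x≡) (s≤s (ℕ.≤-trans (ℕ.m≤m+n r _) (ℕ.m≤n+m _ y)))
  where
  x≡ : x ≡ suc y ℕ.+ suc q ℕ.* r
  x≡ = ℤ.+-injective (trans eq (cong (λ z → + suc y ℤ.+ z) (sym (ℤ.pos-* (suc q) r))))

label-shift≡0 : ∀ {r} (i t : Fin r) q → label t ≡ label i ℤ.+ q ℤ.* + r → q ≡ 0ℤ
label-shift≡0 i t (+ zero)   _  = refl
label-shift≡0 i t +[1+ q ]   eq = contradiction (Fin.toℕ<n t) (ℕ.<⇒≱ (exceeds-period q eq))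
label-shift≡0 {r} i t -[1+ q ] eq = contradiction (Fin.toℕ<n i) (ℕ.<⇒≱ (exceeds-period q i≡))
  where
  cancel : ∀ x z c → x ≡ (x ℤ.+ (- z) ℤ.* c) ℤ.+ z ℤ.* c
  cancel = ℤ-Ring.solve-∀
  i≡ : label i ≡ label t ℤ.+ +[1+ q ] ℤ.* + r
  i≡ = trans (cancel (label i) +[1+ q ] (+ r)) (cong (ℤ._+ +[1+ q ] ℤ.* + r) (sym eq))

fw-preimage-of-label : ∀ {m r} (w : Fin r → ℕ) → sum (map w (allFin r)) ≡ m →
  ∀ {y} (t : Fin r) → FwRel m r w y (label t) → ∃ λ (s : Fin m) → y ≡ label s
fw-preimage-of-label {m} w Σw≡m t (q , i , _ , y≡ , pref<s , s≤pref+w , label≡)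
  with label-shift≡0 i t q label≡ | pref<s
... | refl | s≤s {n = s′} _ = fromℕ< s≤m , trans y≡ (cong (λ x → + suc x) (sym (Fin.toℕ-fromℕ< s≤m)))
  where
  s≤m : suc s′ ≤ m
  s≤m = ℕ.≤-trans s≤pref+w (subst (pref w i ℕ.+ w i ≤_) Σw≡m (pref+w≤sum w i))

injective⇒surjective : ∀ {n} {π : Fin n → Fin n} → Injective _≡_ _≡_ π → ∀ t → ∃ λ j → π j ≡ t
injective⇒surjective {suc n} {π} π-injective t with Fin.any? (λ j → π j Fin.≟ t)
... | yes hit = hit
... | no miss = contradiction (Fin.pigeonhole (ℕ.n<1+n n) squeeze) no-collision
  where
  t≢π : ∀ j → t ≢ π j
  t≢π j t≡πj = miss (j , sym t≡πj)
  squeeze : Fin (suc n) → Fin n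
  squeeze j = punchOut (t≢π j)
  no-collision : ¬ ∃₂ λ i j → i Fin.< j × squeeze i ≡ squeeze j
  no-collision (i , j , i<j , same) =
    Fin.<-irrefl (π-injective (Fin.punchOut-injective (t≢π i) (t≢π j) same)) i<j

γv-matching⇒≗ : ∀ {m n} → Coprime (suc m) n → (a a' : Fin (suc m) → ℕ) →
  (∀ j → 0ℤ ℤ.≤ γv (suc m) n a j) → (∀ j → 0ℤ ℤ.≤ γv (suc m) n a' j) →
  (k k' : ℤ) (π : Fin (suc m) → Fin (suc m)) →
  (∀ j → γv (suc m) n a j ℤ.- k ≡ γv (suc m) n a' (π j) ℤ.- k') →
  ∀ j → a' j ≡ a j
γv-matching⇒≗ {m} {n} cop a a' γ≥0 γ'≥0 k k' π match j =
  trans (cong a' (proj₁ aligned)) (sym (proj₂ aligned))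
  where
  g : Fin (suc m) → ℤ
  g = γv (suc m) n a
  g' : Fin (suc m) → ℤ
  g' = γv (suc m) n a'
  π-injective : Injective _≡_ _≡_ π
  π-injective {i} {j} πi≡πj = proj₁ (γv-injective cop a a (∙-cancelʳ (- k) (g i) (g j)
    (trans (match i) (trans (cong (λ t → g' t ℤ.- k') πi≡πj) (sym (match j))))))
  k≤k' : k ℤ.≤ k'
  k≤k' = i-k≡j-l⇒i≤j⇒k≤l (match Fin.zero) (ℤ.≤-trans (γv-zero≤0 n a) (γ'≥0 (π Fin.zero)))
  hit-zero : ∃ λ j₀ → π j₀ ≡ Fin.zero
  hit-zero = injective⇒surjective π-injective Fin.zero
  k'≤k : k' ℤ.≤ k
  k'≤k = i-k≡j-l⇒i≤j⇒k≤l
    (trans (cong (λ t → g' t ℤ.- k') (sym (proj₂ hit-zero))) (sym (match (proj₁ hit-zero))))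
    (ℤ.≤-trans (γv-zero≤0 n a') (γ≥0 (proj₁ hit-zero)))
  aligned : j ≡ π j × a j ≡ a' (π j)
  aligned = γv-injective cop a a' (∙-cancelʳ (- k) (g j) (g' (π j))
    (trans (match j) (cong (λ z → g' (π j) ℤ.- z) (ℤ.≤-antisym k'≤k k≤k'))))

IsAImage-at-γ : ∀ {m n r} a L g (image : IsAImage m n r a L g) →
  ∀ j → g (γv m n a j ℤ.- proj₁ image) ≡ L j
IsAImage-at-γ {m} {n} {r} a L g (k , _ , on-orbit) j = begin
  g (γv m n a j ℤ.- k)                  ≡⟨ cong (λ x → g (x ℤ.- k)) (sym (ℤ.+-identityʳ (γv m n a j))) ⟩
  g (γv m n a j ℤ.+ 0ℤ ℤ.* + m ℤ.- k)   ≡⟨ on-orbit j 0ℤ ⟩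
  L j ℤ.+ 0ℤ ℤ.* + r                    ≡⟨ ℤ.+-identityʳ (L j) ⟩
  L j                                   ∎
  where open ≡-Reasoning

mainTheorem9 : (m n r : ℕ) → 0 < m → 0 < n → 0 < r → Coprime m n →
    (w : Fin r → ℕ) → sum (map w (allFin r)) ≡ m →
    (a : Fin m → ℕ) (Υ : Fin m → Fin r) → IsSSPF m n r w a Υ →
    (f : ℤ → ℤ) → IsAImage m n r a (lab Υ) f →
    (σ : ℤ → ℤ) → IsAffinePerm m σ →
    (∀ x → FwRel m r w (σ x) (f x)) → StdOrder m r w σ →
    (a' : Fin m → ℕ) (φ : Fin m → Fin m) → IsPF m n a' φ →
    IsAImage m n m a' (lab φ) σ →
    ∀ (j : Fin m) → a' j ≡ a j
mainTheorem9 (suc m) n r _ _ _ cop w Σw≡m a Υ ((_ , γ≥0) , _) f f-image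
  σ ((σ-injective , _) , _) f≡fw∘σ _ a' φ ((_ , γ'≥0) , (_ , φ-surjective) , _) σ-image =
  γv-matching⇒≗ cop a a' γ≥0 γ'≥0 k k' (λ j → proj₁ (partner j)) (λ j → proj₂ (partner j))
  where
  k k' : ℤ
  k = proj₁ f-image
  k' = proj₁ σ-image
  partner : ∀ j → ∃ λ j' → γv (suc m) n a j ℤ.- k ≡ γv (suc m) n a' j' ℤ.- k'
  partner j = j' , σ-injective (trans σx≡label-s (sym σx'≡label-s))
    where
    x : ℤ
    x = γv (suc m) n a j ℤ.- k
    fx≡label : f x ≡ label (Υ j)
    fx≡label = IsAImage-at-γ a (lab Υ) f f-image j
    σx-is-label : ∃ λ s → σ x ≡ label s
    σx-is-label = fw-preimage-of-label w Σw≡m (Υ j)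
      (subst (FwRel (suc m) r w (σ x)) fx≡label (f≡fw∘σ x))
    s : Fin (suc m)
    s = proj₁ σx-is-label
    σx≡label-s : σ x ≡ label s
    σx≡label-s = proj₂ σx-is-label
    j' : Fin (suc m)
    j' = proj₁ (φ-surjective s)
    σx'≡label-s : σ (γv (suc m) n a' j' ℤ.- k') ≡ label s
    σx'≡label-s = trans (IsAImage-at-γ a' (lab φ) σ σ-image j')
      (cong label (proj₂ (φ-surjective s) refl))
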